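{- Let $F_1$ and $F_2$ be finite fields with $|F_1|\le|F_2|$. Then there exists an $|F_1|\times|F_2|$ Latin-sum array (with $A=F_1$, $B=F_2$) over an alphabet $C$ with $$|C|=\begin{cases}4, & F_1=F_2=\mathbb{Z}_3,\\ |F_2|, & \text{otherwise}.\end{cases}$$
   Context: Let $F_1,F_2$ be finite fields with $|F_1|\le|F_2|$, $A\subseteq F_1$, $B\subseteq F_2$ with $|A|\le|B|$. A table $L$ of size $|A|\times|B|$ with entries from a set $C$, rows indexed by elements of $A$ and columns by elements of $B$, is called an $|A|\times|B|$ Latin-sum array over $C$ if for every two distinct pairs $(x_1,y_1)\neq(x_2,y_2)$ in $A\times B$: (i) if $x_1+x_2=0$ in $F_1$ then $L_{x_1,y_1}\neq L_{x_2,y_2}$; and (ii) if $y_1+y_2=0$ in $F_2$ then $L_{x_1,y_1}\neq L_{x_2,y_2}$. -}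

module Defs where

open import Level using (0ℓ)
open import Data.Nat using (ℕ)
open import Data.Fin using (Fin)
open import Data.Product using (_×_; _,_; ∃)
open import Relation.Binary.PropositionalEquality using (_≡_; _≢_)
open import Algebra.Core using (Op₁; Op₂)
open import Algebra.Structures using (IsCommutativeRing)
open import Function.Bundles using (_↔_)

record FiniteField : Set₁ where
  infixl 6 _+_
  infixl 7 _*_
  field
    Carrier : Set
    _+_ : Op₂ Carrier
    _*_ : Op₂ Carrier
    -_  : Op₁ Carrier
    0#  : Carrier
    1#  : Carrier
    isCommutativeRing : IsCommutativeRing _≡_ _+_ _*_ -_ 0# 1#
    0≢1     : 0# ≢ 1#
    inverse : ∀ x → x ≢ 0# → ∃ λ y → x * y ≡ 1#
    size    : ℕ
    enum    : Fin size ↔ Carrier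

open FiniteField public using (Carrier; size)

IsLatinSum : (F₁ F₂ : FiniteField) {c : ℕ} → (Carrier F₁ → Carrier F₂ → Fin c) → Set
IsLatinSum F₁ F₂ L =
  ∀ x₁ y₁ x₂ y₂ → (x₁ , y₁) ≢ (x₂ , y₂) →
    (FiniteField._+_ F₁ x₁ x₂ ≡ FiniteField.0# F₁ → L x₁ y₁ ≢ L x₂ y₂)
  × (FiniteField._+_ F₂ y₁ y₂ ≡ FiniteField.0# F₂ → L x₁ y₁ ≢ L x₂ y₂)

HasLatinSumArray : (F₁ F₂ : FiniteField) → ℕ → Set
HasLatinSumArray F₁ F₂ c = ∃ λ (L : Carrier F₁ → Carrier F₂ → Fin c) → IsLatinSum F₁ F₂ L

-- Only addition and negation matter: rows x and -x (columns y and -y) must carry disjoint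
-- sets of colours, and a row or column with x = -x must be injective.  In characteristic 2
-- negation is the identity and x ↦ x + 1 pairs off the elements, so |F| = 2k; in odd
-- characteristic negation fixes only 0, so F is 0 together with k pairs ±i and |F| = 2k + 1.
-- Along embeddings turning negation into these canonical involutions, an array is written
-- down for each parity combination: the addition table of F₂ when both have characteristic 2,
-- rows shifted by punchIn for mixed parities, and for two odd fields a square sending the rows
-- ±i to the colours ±_, with a fixed-point-free map keeping the columns ±j apart.  That map
-- needs k₂ ≥ 2; for ℤ₃ × ℤ₃ two sign bits give an array with 4 colours.
module Submission where

open import Defs
open import Data.Nat using (_≤_)
open import Data.Product using (_×_)
open import Relation.Binary.PropositionalEquality using (_≡_)
open import Relation.Nullary using (¬_)

open import Level using (0ℓ)
open import Algebra.Bundles using (Group)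
open import Algebra.Core using (Op₂)
open import Algebra.Definitions using (Involutive; LeftCancellative; RightCancellative)
import Algebra.Properties.Group as GroupProperties
open import Algebra.Structures using (IsCommutativeRing)
open import Axiom.UniquenessOfIdentityProofs.WithK using (uip)
open import Data.Bool using (Bool; true; false; T; if_then_else_)
open import Data.Bool.Properties using (T-irrelevant)
open import Data.Empty using (⊥; ⊥-elim)
open import Data.Fin as Fin using (Fin; zero; suc; toℕ; inject≤; punchIn; join; _↑ˡ_; _↑ʳ_)
open import Data.Fin.Permutation using (↔⇒≡)
open import Data.Fin.Properties
  using ( 0↔⊥; 1↔⊤; 2↔Bool; +↔⊎; *↔×; toℕ-injective; toℕ<n; toℕ-↑ˡ; toℕ-↑ʳ; suc-injective
        ; inject≤-injective; punchIn-injective; punchInᵢ≢i )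
open import Data.Nat using (ℕ; zero; suc; pred; _+_; _<_; _<ᵇ_; z≤n; s≤s; s≤s⁻¹; ⌊_/2⌋)
open import Data.Nat.Properties
  using ( <-cmp; <⇒<ᵇ; <ᵇ⇒<; <-irrefl; <-asym; ≮⇒≥; ≰⇒>; <⇒≱; ≤-trans; ≤-reflexive; n≤1+n; m≤n+m
        ; +-suc; +-mono-≤; +-mono-<; +-monoʳ-≤; +-monoˡ-<; n≡⌊n+n/2⌋; module ≤-Reasoning )
open import Data.Product using (Σ; ∃; _,_; proj₁; proj₂)
open import Data.Product.Algebra using (×-cong)
open import Data.Product.Function.Dependent.Propositional using (Σ-↔)
open import Data.Product.Properties using (Σ-≡,≡→≡)
open import Data.Sum using (_⊎_; inj₁; inj₂; map₁; map₂; swap; reduce)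
open import Data.Sum.Algebra using (⊎-cong)
open import Data.Sum.Properties using (inj₁-injective; inj₂-injective)
open import Data.Unit using (⊤; tt)
open import Function using (_∘_; id)
open import Function.Bundles using (_↔_; _↣_; Inverse; Injection; mk↔ₛ′; mk↣)
open import Function.Construct.Composition using (_↣-∘_)
open import Function.Construct.Identity using (↣-id)
open import Function.Properties.Inverse using (↔-refl; ↔-sym; ↔-trans; ↔⇒↣)
open import Relation.Binary.Definitions using (tri<; tri≈; tri>)
open import Relation.Binary.PropositionalEquality
  using (_≢_; refl; sym; trans; cong; cong₂; subst; subst₂; module ≡-Reasoning)
open import Relation.Nullary using (yes; no)
open import Relation.Nullary.Decidable using (via-injection)

open Inverse using (to; from; strictlyInverseˡ; strictlyInverseʳ)

-- Finite sets

Σ-Fin-suc-↔ : ∀ {n} (P : Fin (suc n) → Set) → Σ (Fin (suc n)) P ↔ (P zero ⊎ Σ (Fin n) (P ∘ suc))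
Σ-Fin-suc-↔ P = mk↔ₛ′
  (λ { (zero , p) → inj₁ p ; (suc i , p) → inj₂ (i , p) })
  (λ { (inj₁ p) → zero , p ; (inj₂ (i , p)) → suc i , p })
  (λ { (inj₁ _) → refl ; (inj₂ _) → refl })
  (λ { (zero , _) → refl ; (suc _ , _) → refl })

T↔Fin : ∀ b → T b ↔ Fin (if b then 1 else 0)
T↔Fin true  = ↔-sym 1↔⊤
T↔Fin false = ↔-sym 0↔⊥

Fin-subset-finite : ∀ {n} (p : Fin n → Bool) → ∃ λ k → Fin k ↔ Σ (Fin n) (T ∘ p)
Fin-subset-finite {zero}  p = 0 , mk↔ₛ′ (λ ()) (λ { (() , _) }) (λ { (() , _) }) (λ ())
Fin-subset-finite {suc n} p with Fin-subset-finite (p ∘ suc)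
... | k , e = (if p zero then 1 else 0) + k
            , ↔-trans +↔⊎ (↔-trans (⊎-cong (↔-sym (T↔Fin (p zero))) e) (↔-sym (Σ-Fin-suc-↔ (T ∘ p))))

subset-finite : ∀ {X : Set} {n} → Fin n ↔ X → (p : X → Bool) → ∃ λ k → Fin k ↔ Σ X (T ∘ p)
subset-finite enum p with Fin-subset-finite (p ∘ to enum)
... | k , e = k , ↔-trans e (Σ-↔ enum ↔-refl)

-- Involutions on finite sets

mirror : ∀ {Φ A : Set} → Φ ⊎ (A ⊎ A) → Φ ⊎ (A ⊎ A)
mirror = map₂ swap

Signed : ℕ → Set
Signed k = ⊤ ⊎ (Fin k ⊎ Fin k)

pattern 0ₛ    = inj₁ tt
pattern pos i = inj₂ (inj₁ i)
pattern neg i = inj₂ (inj₂ i)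

pos-injective : ∀ {Φ A : Set} {i j : A} → _≡_ {A = Φ ⊎ (A ⊎ A)} (pos i) (pos j) → i ≡ j
pos-injective refl = refl

neg-injective : ∀ {Φ A : Set} {i j : A} → _≡_ {A = Φ ⊎ (A ⊎ A)} (neg i) (neg j) → i ≡ j
neg-injective refl = refl

pairs↔Fin : ∀ {Φ : Set} {f k} → Φ ↔ Fin f → (Φ ⊎ (Fin k ⊎ Fin k)) ↔ Fin (f + (k + k))
pairs↔Fin φ = ↔-sym (↔-trans +↔⊎ (⊎-cong (↔-sym φ) +↔⊎))

record OrbitDecomposition {X : Set} (σ : X → X) (Φ : Set) : Set where
  field
    pairs   : ℕ
    split   : X ↔ (Φ ⊎ (Fin pairs ⊎ Fin pairs))
    split-σ : ∀ x → to split (σ x) ≡ mirror (to split x)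

decomposition-size : ∀ {X Φ : Set} {n f} {σ : X → X} → Fin n ↔ X → Φ ↔ Fin f →
  (d : OrbitDecomposition σ Φ) → n ≡ f + (OrbitDecomposition.pairs d + OrbitDecomposition.pairs d)
decomposition-size enum φ d = ↔⇒≡ (↔-trans enum (↔-trans (OrbitDecomposition.split d) (pairs↔Fin φ)))

module Involution {X : Set} {n} (enum : Fin n ↔ X) (σ : X → X) (σ-involutive : Involutive _≡_ σ) where

  Fixed : Set
  Fixed = Σ X λ x → σ x ≡ x

  private
    rank : X → ℕ
    rank = toℕ ∘ from enum

    rank-injective : ∀ {x y} → rank x ≡ rank y → x ≡ y
    rank-injective {x} {y} eq = begin
      x                     ≡⟨ strictlyInverseˡ enum x ⟨
      to enum (from enum x) ≡⟨ cong (to enum) (toℕ-injective eq) ⟩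
      to enum (from enum y) ≡⟨ strictlyInverseˡ enum y ⟩
      y                     ∎
      where open ≡-Reasoning

    below? : X → Bool
    below? x = rank x <ᵇ rank (σ x)

    pairs : ℕ
    pairs = proj₁ (subset-finite enum below?)

    below-enum : Fin pairs ↔ Σ X (T ∘ below?)
    below-enum = proj₂ (subset-finite enum below?)

    -- Each free orbit {x, σ x} is represented by its element of smaller rank.
    data Orbit (x : X) : Set where
      fixed : σ x ≡ x → Orbit x
      below : T (below? x) → Orbit x
      above : T (below? (σ x)) → Orbit x

    orbit : ∀ x → Orbit x
    orbit x with <-cmp (rank x) (rank (σ x))
    ... | tri< x<σx _ _ = below (<⇒<ᵇ x<σx)
    ... | tri≈ _ x≡σx _ = fixed (sym (rank-injective x≡σx))
    ... | tri> _ _ σx<x = above (<⇒<ᵇ (subst (λ y → rank (σ x) < rank y) (sym (σ-involutive x)) σx<x))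

    below-irreflexive : ∀ {x} → σ x ≡ x → ¬ T (below? x)
    below-irreflexive σx≡x b = <-irrefl (cong rank (sym σx≡x)) (<ᵇ⇒< _ _ b)

    below-asymmetric : ∀ {x} → T (below? x) → ¬ T (below? (σ x))
    below-asymmetric {x} b b′ =
      <-asym (<ᵇ⇒< _ _ b) (subst (λ y → rank (σ x) < rank y) (σ-involutive x) (<ᵇ⇒< _ _ b′))

    orbit-unique : ∀ {x} (o o′ : Orbit x) → o ≡ o′
    orbit-unique (fixed f) (fixed f′) = cong fixed (uip f f′)
    orbit-unique (below b) (below b′) = cong below (T-irrelevant b b′)
    orbit-unique (above a) (above a′) = cong above (T-irrelevant a a′)
    orbit-unique (fixed f) (below b)  = ⊥-elim (below-irreflexive f b)
    orbit-unique (below b) (fixed f)  = ⊥-elim (below-irreflexive f b)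
    orbit-unique (fixed f) (above a)  = ⊥-elim (below-irreflexive (cong σ f) a)
    orbit-unique (above a) (fixed f)  = ⊥-elim (below-irreflexive (cong σ f) a)
    orbit-unique (below b) (above a)  = ⊥-elim (below-asymmetric b a)
    orbit-unique (above a) (below b)  = ⊥-elim (below-asymmetric b a)

    Parts : Set
    Parts = Fixed ⊎ (Fin pairs ⊎ Fin pairs)

    classify : ∀ x → Orbit x → Parts
    classify x (fixed f) = inj₁ (x , f)
    classify x (below b) = pos (from below-enum (x , b))
    classify x (above a) = neg (from below-enum (σ x , a))

    split : X → Parts
    split x = classify x (orbit x)

    merge : Parts → X
    merge (inj₁ (x , _)) = x
    merge (pos i)        = proj₁ (to below-enum i)
    merge (neg i)        = σ (proj₁ (to below-enum i))

    merge-classify : ∀ x o → merge (classify x o) ≡ x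
    merge-classify x (fixed f) = refl
    merge-classify x (below b) = cong proj₁ (strictlyInverseˡ below-enum (x , b))
    merge-classify x (above a) =
      trans (cong (σ ∘ proj₁) (strictlyInverseˡ below-enum (σ x , a))) (σ-involutive x)

    split-below : ∀ x (b : T (below? x)) → split x ≡ pos (from below-enum (x , b))
    split-below x b = cong (classify x) (orbit-unique _ (below b))

    split-above : ∀ x (b : T (below? x)) → split (σ x) ≡ neg (from below-enum (x , b))
    split-above x b = begin
      classify (σ x) (orbit (σ x))
        ≡⟨ cong (classify (σ x)) (orbit-unique _ (above b′)) ⟩
      neg (from below-enum (σ (σ x) , b′))
        ≡⟨ cong (neg ∘ from below-enum) (Σ-≡,≡→≡ (σ-involutive x , T-irrelevant _ _)) ⟩
      neg (from below-enum (x , b))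
        ∎
      where
      open ≡-Reasoning
      b′ : T (below? (σ (σ x)))
      b′ = subst (T ∘ below?) (sym (σ-involutive x)) b

    split-merge : ∀ p → split (merge p) ≡ p
    split-merge (inj₁ (x , f)) = cong (classify x) (orbit-unique _ (fixed f))
    split-merge (pos i) = trans (split-below _ (proj₂ (to below-enum i))) (cong pos (strictlyInverseʳ below-enum i))
    split-merge (neg i) = trans (split-above _ (proj₂ (to below-enum i))) (cong neg (strictlyInverseʳ below-enum i))

    merge-mirror : ∀ p → merge (mirror p) ≡ σ (merge p)
    merge-mirror (inj₁ (x , f)) = sym f
    merge-mirror (pos i)        = refl
    merge-mirror (neg i)        = sym (σ-involutive _)

    parts : X ↔ Parts
    parts = mk↔ₛ′ split merge split-merge (λ x → merge-classify x (orbit x))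

    split-σ : ∀ x → split (σ x) ≡ mirror (split x)
    split-σ x = begin
      split (σ x)                      ≡⟨ cong (split ∘ σ) (strictlyInverseʳ parts x) ⟨
      split (σ (merge (split x)))      ≡⟨ cong split (merge-mirror (split x)) ⟨
      split (merge (mirror (split x))) ≡⟨ split-merge (mirror (split x)) ⟩
      mirror (split x)                 ∎
      where open ≡-Reasoning

  decompose : ∀ {Φ} → Fixed ↔ Φ → OrbitDecomposition σ Φ
  decompose φ = record
    { pairs   = pairs
    ; split   = ↔-trans parts (⊎-cong φ ↔-refl)
    ; split-σ = λ x → trans (cong (map₁ (to φ)) (split-σ x)) (map₁-mirror (split x))
    }
    where
    map₁-mirror : ∀ p → map₁ (to φ) (mirror p) ≡ mirror (map₁ (to φ) p)
    map₁-mirror (inj₁ _) = refl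
    map₁-mirror (pos _)  = refl
    map₁-mirror (neg _)  = refl

  unique-fixed-point : ∀ x₀ → σ x₀ ≡ x₀ → (∀ x → σ x ≡ x → x ≡ x₀) → Fixed ↔ ⊤
  unique-fixed-point x₀ f₀ unique = mk↔ₛ′ _ (λ _ → x₀ , f₀) (λ _ → refl)
    λ { (x , f) → Σ-≡,≡→≡ (sym (unique x f) , uip _ _) }

  no-fixed-point : (∀ x → σ x ≢ x) → Fixed ↔ ⊥
  no-fixed-point free =
    mk↔ₛ′ (λ { (x , f) → free x f }) (λ ()) (λ ()) (λ { (x , f) → ⊥-elim (free x f) })

-- Finite fields

record Embedding (F : FiniteField) {A : Set} (σ : A → A) : Set where
  field
    embed           : Carrier F → A
    embed-injective : ∀ {x y} → embed x ≡ embed y → x ≡ y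
    embed-neg       : ∀ x → embed (FiniteField.-_ F x) ≡ σ (embed x)

char2-embedding : ∀ (F : FiniteField) {A : Set} →
  (∀ x → FiniteField.-_ F x ≡ x) → Carrier F ↣ A → Embedding F (id {A = A})
char2-embedding F neg≡id f = record
  { embed           = Injection.to f
  ; embed-injective = Injection.injective f
  ; embed-neg       = λ x → cong (Injection.to f) (neg≡id x)
  }

SignedEmbedding : FiniteField → ℕ → Set
SignedEmbedding F k = Embedding F (mirror {⊤} {Fin k})

data Shape (F : FiniteField) : Set where
  char2 : ∀ k → size F ≡ k + k → (∀ x → FiniteField.-_ F x ≡ x) → Shape F
  odd   : ∀ k → size F ≡ suc (k + k) → SignedEmbedding F k → Shape F

module FieldProperties (F : FiniteField) where
  open FiniteField F hiding (size; Carrier) renaming (_+_ to _⊕_)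
  open IsCommutativeRing isCommutativeRing
    using (+-isGroup; -‿inverseˡ; +-assoc; +-identityʳ; *-assoc; *-comm; *-identityˡ; distribʳ; zeroˡ; zeroʳ)

  private
    +-group : Group 0ℓ 0ℓ
    +-group = record { isGroup = +-isGroup }

  open GroupProperties +-group public using (∙-cancelˡ; ∙-cancelʳ; inverseʳ-unique)
  open GroupProperties +-group using (⁻¹-involutive; ε⁻¹≈ε)

  double : ∀ x → x ⊕ x ≡ (1# ⊕ 1#) * x
  double x = sym (trans (distribʳ x 1# 1#) (cong₂ _⊕_ (*-identityˡ x) (*-identityˡ x)))

  char2⇒neg≡id : 1# ⊕ 1# ≡ 0# → ∀ x → - x ≡ x
  char2⇒neg≡id 2≡0 x = sym (inverseʳ-unique x x (trans (double x) (trans (cong (_* x) 2≡0) (zeroˡ x))))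

  odd⇒neg-fixed≡0 : 1# ⊕ 1# ≢ 0# → ∀ x → - x ≡ x → x ≡ 0#
  odd⇒neg-fixed≡0 2≢0 x -x≡x = begin
    x                   ≡⟨ *-identityˡ x ⟨
    1# * x              ≡⟨ cong (_* x) ½*2≡1 ⟨
    (½ * (1# ⊕ 1#)) * x ≡⟨ *-assoc ½ (1# ⊕ 1#) x ⟩
    ½ * ((1# ⊕ 1#) * x) ≡⟨ cong (½ *_) (double x) ⟨
    ½ * (x ⊕ x)         ≡⟨ cong (λ y → ½ * (y ⊕ x)) -x≡x ⟨
    ½ * (- x ⊕ x)       ≡⟨ cong (½ *_) (-‿inverseˡ x) ⟩
    ½ * 0#              ≡⟨ zeroʳ ½ ⟩
    0#                  ∎
    where
    open ≡-Reasoning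
    ½ : Carrier F
    ½ = proj₁ (inverse (1# ⊕ 1#) 2≢0)
    ½*2≡1 : ½ * (1# ⊕ 1#) ≡ 1#
    ½*2≡1 = trans (*-comm ½ _) (proj₂ (inverse (1# ⊕ 1#) 2≢0))

  +1-involutive : 1# ⊕ 1# ≡ 0# → Involutive _≡_ (_⊕ 1#)
  +1-involutive 2≡0 x = trans (+-assoc x 1# 1#) (trans (cong (x ⊕_) 2≡0) (+-identityʳ x))

  +1-fixedPointFree : ∀ x → x ⊕ 1# ≢ x
  +1-fixedPointFree x x+1≡x = 0≢1 (sym (∙-cancelˡ x 1# 0# (trans x+1≡x (sym (+-identityʳ x)))))

  index : ∀ {n} → size F ≤ n → Carrier F ↣ Fin n
  index size≤n = mk↣ (inject≤-injective size≤n size≤n _ _) ↣-∘ ↔⇒↣ (↔-sym enum)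

  size≢1 : size F ≢ 1
  size≢1 size≡1 = 0≢1 (Injection.injective (↔⇒↣ (↔-sym enum)) (Fin1-unique size≡1 _ _))
    where
    Fin1-unique : ∀ {n} → n ≡ 1 → (i j : Fin n) → i ≡ j
    Fin1-unique refl zero zero = refl

  shape : Shape F
  shape with via-injection (↔⇒↣ (↔-sym enum)) Fin._≟_ (1# ⊕ 1#) 0#
  ... | yes 2≡0 = char2 pairs (decomposition-size enum (↔-sym 0↔⊥) d) (char2⇒neg≡id 2≡0)
    where
    open Involution enum (_⊕ 1#) (+1-involutive 2≡0)
    d : OrbitDecomposition (_⊕ 1#) ⊥
    d = decompose (no-fixed-point +1-fixedPointFree)
    open OrbitDecomposition d
  ... | no 2≢0 = odd pairs (decomposition-size enum (↔-sym 1↔⊤) d) record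
    { embed           = to split
    ; embed-injective = Injection.injective (↔⇒↣ split)
    ; embed-neg       = split-σ
    }
    where
    open Involution enum -_ ⁻¹-involutive
    d : OrbitDecomposition -_ ⊤
    d = decompose (unique-fixed-point 0# ε⁻¹≈ε (odd⇒neg-fixed≡0 2≢0))
    open OrbitDecomposition d

-- Latin-sum arrays on models

record LatinSum {A B C : Set} (σ : A → A) (τ : B → B) (L : A → B → C) : Set where
  field
    rows    : ∀ a b b′ → L a b ≡ L (σ a) b′ → (a , b) ≡ (σ a , b′)
    columns : ∀ a a′ b → L a b ≡ L a′ (τ b) → (a , b) ≡ (a′ , τ b)

latinSum⇒array : ∀ {F₁ F₂ : FiniteField} {A B C : Set} {σ : A → A} {τ : B → B} {L : A → B → C} {c} →
  Embedding F₁ σ → Embedding F₂ τ → C ↔ Fin c → LatinSum σ τ L → HasLatinSumArray F₁ F₂ c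
latinSum⇒array {F₁} {F₂} {σ = σ} {τ} {L} e₁ e₂ κ latin =
  (λ x y → to κ (L (embed e₁ x) (embed e₂ y))) , λ x₁ y₁ x₂ y₂ ≢ →
      (λ sum≡0 eq → ≢ (embed-pair (row-pair (embed-sum≡0 e₁ sum≡0) (κ-injective eq))))
    , (λ sum≡0 eq → ≢ (embed-pair (column-pair (embed-sum≡0 e₂ sum≡0) (κ-injective eq))))
  where
  open Embedding
  open LatinSum latin

  κ-injective : ∀ {u v} → to κ u ≡ to κ v → u ≡ v
  κ-injective = Injection.injective (↔⇒↣ κ)

  embed-sum≡0 : ∀ {F A} {ν : A → A} (e : Embedding F ν) {x x′} →
    FiniteField._+_ F x x′ ≡ FiniteField.0# F → embed e x′ ≡ ν (embed e x)
  embed-sum≡0 {F} e {x} {x′} sum≡0 =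
    trans (cong (embed e) (FieldProperties.inverseʳ-unique F x x′ sum≡0)) (embed-neg e x)

  embed-pair : ∀ {x₁ y₁ x₂ y₂} →
    (embed e₁ x₁ , embed e₂ y₁) ≡ (embed e₁ x₂ , embed e₂ y₂) → (x₁ , y₁) ≡ (x₂ , y₂)
  embed-pair eq = cong₂ _,_ (embed-injective e₁ (cong proj₁ eq)) (embed-injective e₂ (cong proj₂ eq))

  row-pair : ∀ {a b a′ b′} → a′ ≡ σ a → L a b ≡ L a′ b′ → (a , b) ≡ (a′ , b′)
  row-pair refl = rows _ _ _

  column-pair : ∀ {a b a′ b′} → b′ ≡ τ b → L a b ≡ L a′ b′ → (a , b) ≡ (a′ , b′)
  column-pair refl = columns _ _ _

cancellative⇒latinSum : ∀ {A : Set} {_∙_ : Op₂ A} →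
  LeftCancellative _≡_ _∙_ → RightCancellative _≡_ _∙_ → LatinSum id id _∙_
cancellative⇒latinSum cancelˡ cancelʳ = record
  { rows    = λ a b b′ eq → cong (a ,_) (cancelˡ a b b′ eq)
  ; columns = λ a a′ b eq → cong (_, b) (cancelʳ b a a′ eq)
  }

-- Row pos i only uses colours pos _, row neg i only neg _; column pos j only holds pos j and
-- neg (d j), column neg j only neg j and pos (d j).
module SignedSquare {k₁ k₂} (k₁≤k₂ : k₁ ≤ k₂)
                    (d : Fin k₂ → Fin k₂) (d-fixedPointFree : ∀ j → d j ≢ j) where

  entry : Fin k₁ → Signed k₂ → Fin k₂
  entry i 0ₛ      = inject≤ i k₁≤k₂
  entry i (pos j) = j
  entry i (neg j) = d j

  square : Signed k₁ → Signed k₂ → Signed k₂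
  square 0ₛ      b = b
  square (pos i) b = pos (entry i b)
  square (neg i) b = neg (entry i (mirror b))

  column₀-injective : ∀ a a′ → square a 0ₛ ≡ square a′ 0ₛ → a ≡ a′
  column₀-injective 0ₛ      0ₛ       _  = refl
  column₀-injective (pos i) (pos i′) eq = cong pos (inject≤-injective k₁≤k₂ k₁≤k₂ i i′ (pos-injective eq))
  column₀-injective (neg i) (neg i′) eq = cong neg (inject≤-injective k₁≤k₂ k₁≤k₂ i i′ (neg-injective eq))
  column₀-injective 0ₛ      (pos _)  ()
  column₀-injective 0ₛ      (neg _)  ()
  column₀-injective (pos _) 0ₛ       ()
  column₀-injective (pos _) (neg _)  ()
  column₀-injective (neg _) 0ₛ       ()
  column₀-injective (neg _) (pos _)  ()

  opposite-columns-disjoint : ∀ a a′ j → square a (pos j) ≢ square a′ (neg j)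
  opposite-columns-disjoint 0ₛ      0ₛ      j ()
  opposite-columns-disjoint 0ₛ      (pos _) j eq = d-fixedPointFree j (sym (pos-injective eq))
  opposite-columns-disjoint 0ₛ      (neg _) j ()
  opposite-columns-disjoint (pos _) 0ₛ      j ()
  opposite-columns-disjoint (pos _) (pos _) j eq = d-fixedPointFree j (sym (pos-injective eq))
  opposite-columns-disjoint (pos _) (neg _) j ()
  opposite-columns-disjoint (neg _) 0ₛ      j eq = d-fixedPointFree j (neg-injective eq)
  opposite-columns-disjoint (neg _) (pos _) j ()
  opposite-columns-disjoint (neg _) (neg _) j eq = d-fixedPointFree j (neg-injective eq)

  latinSum : LatinSum mirror mirror square
  latinSum = record { rows = rows ; columns = columns }
    where
    rows : ∀ a b b′ → square a b ≡ square (mirror a) b′ → (a , b) ≡ (mirror a , b′)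
    rows 0ₛ      b .b refl = refl
    rows (pos _) b b′ ()
    rows (neg _) b b′ ()
    columns : ∀ a a′ b → square a b ≡ square a′ (mirror b) → (a , b) ≡ (a′ , mirror b)
    columns a a′ 0ₛ      eq = cong (_, 0ₛ) (column₀-injective a a′ eq)
    columns a a′ (pos j) eq = ⊥-elim (opposite-columns-disjoint a a′ j eq)
    columns a a′ (neg j) eq = ⊥-elim (opposite-columns-disjoint a′ a j (sym eq))

toℕ≤toℕ-punchIn : ∀ {n} (i : Fin (suc n)) (j : Fin n) → toℕ j ≤ toℕ (punchIn i j)
toℕ≤toℕ-punchIn zero    j       = n≤1+n (toℕ j)
toℕ≤toℕ-punchIn (suc i) zero    = z≤n
toℕ≤toℕ-punchIn (suc i) (suc j) = s≤s (toℕ≤toℕ-punchIn i j)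

-- punchIn (suc i) fixes zero and raises every other j by at most one.
toℕ-punchIn-suc≤double : ∀ {n} (i j : Fin n) → toℕ (punchIn (suc i) j) ≤ toℕ j + toℕ j
toℕ-punchIn-suc≤double i       zero    = z≤n
toℕ-punchIn-suc≤double zero    (suc j) = s≤s (m≤n+m (suc (toℕ j)) (toℕ j))
toℕ-punchIn-suc≤double (suc i) (suc j) = s≤s (begin
  toℕ (punchIn (suc i) j) ≤⟨ toℕ-punchIn-suc≤double i j ⟩
  toℕ j + toℕ j           ≤⟨ +-monoʳ-≤ (toℕ j) (n≤1+n (toℕ j)) ⟩
  toℕ j + suc (toℕ j)     ∎)
  where open ≤-Reasoning

-- Row r lists the colours other than suc r in increasing order, so column pos j only holds
-- colours ≤ 2 j and column neg j only colours ≥ k + j.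
module ShiftedSquare (k : ℕ) where

  square : Fin (k + k) → Signed k → Fin (suc (k + k))
  square r 0ₛ       = suc r
  square r (inj₂ h) = punchIn (suc r) (join k k h)

  opposite-columns-disjoint : ∀ r r′ j → square r (pos j) ≢ square r′ (neg j)
  opposite-columns-disjoint r r′ j eq = <-irrefl (cong toℕ eq) (begin-strict
    toℕ (punchIn (suc r) (j ↑ˡ k))  ≤⟨ toℕ-punchIn-suc≤double r (j ↑ˡ k) ⟩
    toℕ (j ↑ˡ k) + toℕ (j ↑ˡ k)     ≡⟨ cong₂ _+_ (toℕ-↑ˡ j k) (toℕ-↑ˡ j k) ⟩
    toℕ j + toℕ j                   <⟨ +-monoˡ-< (toℕ j) (toℕ<n j) ⟩
    k + toℕ j                       ≡⟨ toℕ-↑ʳ k j ⟨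
    toℕ (k ↑ʳ j)                    ≤⟨ toℕ≤toℕ-punchIn (suc r′) (k ↑ʳ j) ⟩
    toℕ (punchIn (suc r′) (k ↑ʳ j)) ∎)
    where open ≤-Reasoning

  latinSum : LatinSum id mirror square
  latinSum = record { rows = rows ; columns = columns }
    where
    join-injective : ∀ {h h′} → join k k h ≡ join k k h′ → h ≡ h′
    join-injective = Injection.injective (↔⇒↣ (↔-sym (+↔⊎ {k} {k})))
    rows : ∀ r b b′ → square r b ≡ square r b′ → (r , b) ≡ (r , b′)
    rows r 0ₛ       0ₛ        _  = refl
    rows r 0ₛ       (inj₂ h′) eq = ⊥-elim (punchInᵢ≢i (suc r) (join k k h′) (sym eq))
    rows r (inj₂ h) 0ₛ        eq = ⊥-elim (punchInᵢ≢i (suc r) (join k k h) eq)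
    rows r (inj₂ h) (inj₂ h′) eq = cong (λ h → r , inj₂ h) (join-injective (punchIn-injective (suc r) _ _ eq))
    columns : ∀ r r′ b → square r b ≡ square r′ (mirror b) → (r , b) ≡ (r′ , mirror b)
    columns r r′ 0ₛ      eq = cong (_, 0ₛ) (suc-injective eq)
    columns r r′ (pos j) eq = ⊥-elim (opposite-columns-disjoint r r′ j eq)
    columns r r′ (neg j) eq = ⊥-elim (opposite-columns-disjoint r′ r j (sym eq))

-- Row pos i only uses the first half of the colours, row neg i only the second; in column b
-- both avoid the colour b of row 0ₛ.
module HalvedSquare {k m} (k≤m : k ≤ m) where

  square : Signed k → Fin (suc m) ⊎ Fin (suc m) → Fin (suc m) ⊎ Fin (suc m)
  square 0ₛ      b = b
  square (pos i) b = inj₁ (punchIn (reduce b) (inject≤ i k≤m))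
  square (neg i) b = inj₂ (punchIn (reduce b) (inject≤ i k≤m))

  row₀-disjoint : ∀ b s → square 0ₛ b ≢ square (inj₂ s) b
  row₀-disjoint (inj₁ j) (inj₁ i) eq = punchInᵢ≢i j _ (sym (inj₁-injective eq))
  row₀-disjoint (inj₂ j) (inj₂ i) eq = punchInᵢ≢i j _ (sym (inj₂-injective eq))
  row₀-disjoint (inj₁ _) (inj₂ _) ()
  row₀-disjoint (inj₂ _) (inj₁ _) ()

  column-injective : ∀ b a a′ → square a b ≡ square a′ b → a ≡ a′
  column-injective b 0ₛ       0ₛ       _  = refl
  column-injective b 0ₛ       (inj₂ s) eq = ⊥-elim (row₀-disjoint b s eq)
  column-injective b (inj₂ s) 0ₛ       eq = ⊥-elim (row₀-disjoint b s (sym eq))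
  column-injective b (pos i)  (pos i′) eq =
    cong pos (inject≤-injective k≤m k≤m i i′ (punchIn-injective (reduce b) _ _ (inj₁-injective eq)))
  column-injective b (neg i)  (neg i′) eq =
    cong neg (inject≤-injective k≤m k≤m i i′ (punchIn-injective (reduce b) _ _ (inj₂-injective eq)))
  column-injective b (pos _)  (neg _)  ()
  column-injective b (neg _)  (pos _)  ()

  latinSum : LatinSum mirror id square
  latinSum = record { rows = rows ; columns = λ a a′ b eq → cong (_, b) (column-injective b a a′ eq) }
    where
    rows : ∀ a b b′ → square a b ≡ square (mirror a) b′ → (a , b) ≡ (mirror a , b′)
    rows 0ₛ      b .b refl = refl
    rows (pos _) b b′ ()
    rows (neg _) b b′ ()

_orElse_ : ∀ {k} → Signed k → Signed k → Signed k
0ₛ       orElse b = b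
(inj₂ s) orElse b = inj₂ s

isPos isNeg : ∀ {k} → Signed k → Bool
isPos (pos _) = true
isPos _       = false
isNeg (neg _) = true
isNeg _       = false

signs : ∀ {k} → Signed k → Bool × Bool
signs a = isNeg a , isPos a

signs-injective : ∀ {a b : Signed 1} → signs a ≡ signs b → a ≡ b
signs-injective {0ₛ}       {0ₛ}       _ = refl
signs-injective {pos zero} {pos zero} _ = refl
signs-injective {neg zero} {neg zero} _ = refl
signs-injective {0ₛ}       {pos _}    ()
signs-injective {0ₛ}       {neg _}    ()
signs-injective {pos _}    {0ₛ}       ()
signs-injective {pos _}    {neg _}    ()
signs-injective {neg _}    {0ₛ}       ()
signs-injective {neg _}    {pos _}    ()

-- The first bit separates the rows pos and neg, the second bit the columns pos and neg,
-- and row 0ₛ and column 0ₛ both read off signs.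
ternarySquare : Signed 1 → Signed 1 → Bool × Bool
ternarySquare a b = isNeg (a orElse b) , isPos (b orElse a)

ternarySquare-latinSum : LatinSum mirror mirror ternarySquare
ternarySquare-latinSum = record { rows = rows ; columns = columns }
  where
  orElse-0ₛ : ∀ a → a orElse 0ₛ ≡ a
  orElse-0ₛ 0ₛ       = refl
  orElse-0ₛ (inj₂ _) = refl
  row₀ : ∀ b → ternarySquare 0ₛ b ≡ signs b
  row₀ b = cong (isNeg b ,_) (cong isPos (orElse-0ₛ b))
  column₀ : ∀ a → ternarySquare a 0ₛ ≡ signs a
  column₀ a = cong (_, isPos a) (cong isNeg (orElse-0ₛ a))
  rows : ∀ a b b′ → ternarySquare a b ≡ ternarySquare (mirror a) b′ → (a , b) ≡ (mirror a , b′)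
  rows 0ₛ      b b′ eq = cong (0ₛ ,_) (signs-injective (trans (sym (row₀ b)) (trans eq (row₀ b′))))
  rows (pos _) b b′ ()
  rows (neg _) b b′ ()
  columns : ∀ a a′ b → ternarySquare a b ≡ ternarySquare a′ (mirror b) → (a , b) ≡ (a′ , mirror b)
  columns a a′ 0ₛ      eq = cong (_, 0ₛ) (signs-injective (trans (sym (column₀ a)) (trans eq (column₀ a′))))
  columns a a′ (pos _) ()
  columns a a′ (neg _) ()

m+m≤n+n⇒m≤n : ∀ {m n} → m + m ≤ n + n → m ≤ n
m+m≤n+n⇒m≤n m+m≤n+n = ≮⇒≥ λ n<m → <⇒≱ (+-mono-< n<m n<m) m+m≤n+n

m+m<n+n⇒m<n : ∀ {m n} → m + m < n + n → m < n
m+m<n+n⇒m<n m+m<n+n = ≰⇒> λ n≤m → <⇒≱ m+m<n+n (+-mono-≤ n≤m n≤m)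

m+m≤1+n+n⇒m≤n : ∀ {m n} → m + m ≤ suc (n + n) → m ≤ n
m+m≤1+n+n⇒m≤n {n = n} m+m≤1+n+n =
  s≤s⁻¹ (m+m<n+n⇒m<n (≤-trans (s≤s m+m≤1+n+n) (≤-reflexive (cong suc (sym (+-suc n n))))))

m+m≡n⇒m≡⌊n/2⌋ : ∀ {m n} → m + m ≡ n → m ≡ ⌊ n /2⌋
m+m≡n⇒m≡⌊n/2⌋ {m} refl = n≡⌊n+n/2⌋ m

m+m≢3 : ∀ {m} → m + m ≢ 3
m+m≢3 {m} m+m≡3 with m+m≡n⇒m≡⌊n/2⌋ {m} m+m≡3 | m+m≡3
... | refl | ()

derangement : ∀ k → k ≢ 1 → Σ (Fin k → Fin k) λ d → ∀ j → d j ≢ j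
derangement zero          _   = (λ ()) , λ ()
derangement (suc zero)    k≢1 = ⊥-elim (k≢1 refl)
derangement (suc (suc k)) _   = (λ j → punchIn j zero) , λ j → punchInᵢ≢i j zero

bits↔Fin4 : (Bool × Bool) ↔ Fin 4
bits↔Fin4 = ↔-sym (↔-trans (*↔× {2} {2}) (×-cong 2↔Bool 2↔Bool))

-- Arrays on finite fields

module _ (F₁ F₂ : FiniteField) where
  open FieldProperties using (index; ∙-cancelˡ; ∙-cancelʳ)

  array-char2-char2 : (∀ x → FiniteField.-_ F₁ x ≡ x) → (∀ y → FiniteField.-_ F₂ y ≡ y) →
    size F₁ ≤ size F₂ → HasLatinSumArray F₁ F₂ (size F₂)
  array-char2-char2 neg₁ neg₂ size₁≤size₂ = latinSum⇒array
    (char2-embedding F₁ neg₁ (↔⇒↣ (FiniteField.enum F₂) ↣-∘ index F₁ size₁≤size₂))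
    (char2-embedding F₂ neg₂ (↣-id (Carrier F₂)))
    (↔-sym (FiniteField.enum F₂))
    (cancellative⇒latinSum (∙-cancelˡ F₂) (∙-cancelʳ F₂))

  array-char2-odd : ∀ {k} → (∀ x → FiniteField.-_ F₁ x ≡ x) → SignedEmbedding F₂ k →
    size F₂ ≡ suc (k + k) → size F₁ ≤ k + k → HasLatinSumArray F₁ F₂ (size F₂)
  array-char2-odd {k} neg₁ e₂ size₂≡ size₁≤ = latinSum⇒array
    (char2-embedding F₁ neg₁ (index F₁ size₁≤))
    e₂
    (subst (λ c → Fin (suc (k + k)) ↔ Fin c) (sym size₂≡) ↔-refl)
    (ShiftedSquare.latinSum k)

  array-odd-char2 : ∀ {k₁ k₂} → SignedEmbedding F₁ k₁ → (∀ y → FiniteField.-_ F₂ y ≡ y) →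
    size F₂ ≡ k₂ + k₂ → k₁ < k₂ → HasLatinSumArray F₁ F₂ (size F₂)
  array-odd-char2 {k₂ = k₂} e₁ neg₂ size₂≡ (s≤s k₁≤m) = latinSum⇒array
    e₁
    (char2-embedding F₂ neg₂ (↔⇒↣ +↔⊎ ↣-∘ index F₂ (≤-reflexive size₂≡)))
    (subst (λ c → (Fin k₂ ⊎ Fin k₂) ↔ Fin c) (sym size₂≡) (↔-sym +↔⊎))
    (HalvedSquare.latinSum k₁≤m)

  array-odd-odd : ∀ {k₁ k₂} → SignedEmbedding F₁ k₁ → SignedEmbedding F₂ k₂ →
    size F₂ ≡ suc (k₂ + k₂) → k₁ ≤ k₂ → (d : Fin k₂ → Fin k₂) → (∀ j → d j ≢ j) →
    HasLatinSumArray F₁ F₂ (size F₂)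
  array-odd-odd {k₂ = k₂} e₁ e₂ size₂≡ k₁≤k₂ d d-fixedPointFree = latinSum⇒array
    e₁
    e₂
    (subst (λ c → Signed k₂ ↔ Fin c) (sym size₂≡) (pairs↔Fin (↔-sym 1↔⊤)))
    (SignedSquare.latinSum k₁≤k₂ d d-fixedPointFree)

  array-ternary : SignedEmbedding F₁ 1 → SignedEmbedding F₂ 1 → HasLatinSumArray F₁ F₂ 4
  array-ternary e₁ e₂ = latinSum⇒array e₁ e₂ bits↔Fin4 ternarySquare-latinSum

open FieldProperties using (shape; size≢1)

ternaryEmbedding : ∀ {F} → Shape F → size F ≡ 3 → SignedEmbedding F 1
ternaryEmbedding (char2 k size≡k+k _) size≡3 = ⊥-elim (m+m≢3 {k} (trans (sym size≡k+k) size≡3))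
ternaryEmbedding {F} (odd k size≡1+k+k e) size≡3 =
  subst (SignedEmbedding F) (m+m≡n⇒m≡⌊n/2⌋ {k} (cong pred (trans (sym size≡1+k+k) size≡3))) e

sizedArray : ∀ {F₁ F₂} → Shape F₁ → Shape F₂ → size F₁ ≤ size F₂ →
  ¬ (size F₁ ≡ 3 × size F₂ ≡ 3) → HasLatinSumArray F₁ F₂ (size F₂)
sizedArray {F₁} {F₂} (char2 _ _ neg₁) (char2 _ _ neg₂) size₁≤size₂ _ =
  array-char2-char2 F₁ F₂ neg₁ neg₂ size₁≤size₂
sizedArray {F₁} {F₂} (char2 k₁ size₁≡ neg₁) (odd k₂ size₂≡ e₂) size₁≤size₂ _ =
  array-char2-odd F₁ F₂ {k = k₂} neg₁ e₂ size₂≡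
    (subst (_≤ k₂ + k₂) (sym size₁≡) (+-mono-≤ k₁≤k₂ k₁≤k₂))
  where
  k₁≤k₂ : k₁ ≤ k₂
  k₁≤k₂ = m+m≤1+n+n⇒m≤n {k₁} {k₂} (subst₂ _≤_ size₁≡ size₂≡ size₁≤size₂)
sizedArray {F₁} {F₂} (odd k₁ size₁≡ e₁) (char2 k₂ size₂≡ neg₂) size₁≤size₂ _ =
  array-odd-char2 F₁ F₂ {k₁} {k₂} e₁ neg₂ size₂≡
    (m+m<n+n⇒m<n {k₁} {k₂} (subst₂ _≤_ size₁≡ size₂≡ size₁≤size₂))
sizedArray {F₁} {F₂} (odd k₁ size₁≡ e₁) (odd k₂ size₂≡ e₂) size₁≤size₂ ¬3×3 =
  array-odd-odd F₁ F₂ {k₁} {k₂} e₁ e₂ size₂≡ k₁≤k₂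
    (proj₁ (derangement k₂ k₂≢1)) (proj₂ (derangement k₂ k₂≢1))
  where
  k₁≤k₂ : k₁ ≤ k₂
  k₁≤k₂ = m+m≤n+n⇒m≤n {k₁} {k₂} (s≤s⁻¹ (subst₂ _≤_ size₁≡ size₂≡ size₁≤size₂))
  k₂≢1 : k₂ ≢ 1
  k₂≢1 k₂≡1 = excluded k₁ size₁≡ (subst (k₁ ≤_) k₂≡1 k₁≤k₂)
    where
    excluded : ∀ j → size F₁ ≡ suc (j + j) → j ≤ 1 → ⊥
    excluded 0             size₁≡1 _        = size≢1 F₁ size₁≡1
    excluded 1             size₁≡3 _        =
      ¬3×3 (size₁≡3 , subst (λ j → size F₂ ≡ suc (j + j)) k₂≡1 size₂≡)
    excluded (suc (suc _)) _       (s≤s ())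

mainTheorem5 : (F₁ F₂ : FiniteField) → size F₁ ≤ size F₂ →
    ((size F₁ ≡ 3 × size F₂ ≡ 3) → HasLatinSumArray F₁ F₂ 4)
    × (¬ (size F₁ ≡ 3 × size F₂ ≡ 3) → HasLatinSumArray F₁ F₂ (size F₂))
mainTheorem5 F₁ F₂ size₁≤size₂ =
    (λ { (size₁≡3 , size₂≡3) →
           array-ternary F₁ F₂ (ternaryEmbedding (shape F₁) size₁≡3)
                               (ternaryEmbedding (shape F₂) size₂≡3) })
  , sizedArray (shape F₁) (shape F₂) size₁≤size₂
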